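{- Let $N$ be an odd positive integer with $\sigma^*(\sigma^*(N))=2N$ and $N\neq 9,165$. If $3\mid\sigma^*(N)$, then $3\mid N$.
   Context: $\sigma^*(n)$ is the sum of the unitary divisors of $n$, i.e. divisors $d$ of $n$ with $\gcd(d,n/d)=1$. -}

module Defs where

open import Data.Nat using (ℕ; zero; suc; _+_; _*_; _≟_)
open import Data.Nat.Divisibility using (_∣?_)
open import Data.Nat.GCD using (gcd)
open import Data.Nat.DivMod using (_/_)
open import Data.List using (List; []; _∷_; filterᵇ; upTo; map)
open import Data.Nat.ListAction using (sum)
open import Data.Bool using (Bool; true; false; _∧_)
open import Relation.Nullary.Decidable using (⌊_⌋)

isUnitaryDivisorᵇ : ℕ → ℕ → Bool
isUnitaryDivisorᵇ n zero = false
isUnitaryDivisorᵇ n (suc k) =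
  ⌊ suc k ∣? n ⌋ ∧ ⌊ gcd (suc k) (n / suc k) ≟ 1 ⌋

candidates : ℕ → List ℕ
candidates n = map suc (upTo n)

-- σ*(n) = sum of the unitary divisors of n (σ*(0) = 0 by this convention; only used for n ≥ 1).
σ* : ℕ → ℕ
σ* n = sum (filterᵇ (isUnitaryDivisorᵇ n) (candidates n))

{-# OPTIONS --safe #-}
-- Suppose 3 ∤ N. As N > 1 is odd, σ*(N) is even, so σ*(N) = 2^a 3^b r with a, b ≥ 1 and
-- gcd(r, 6) = 1, and multiplicativity turns σ*(σ*(N)) = 2N into 2N = (1 + 2^a)(1 + 3^b) σ*(r).
-- Since 4 ∤ 2N, r = 1 (otherwise σ*(r) is even) and b is even (otherwise 4 ∣ 1 + 3^b); since
-- 3 ∤ N, a is even as well (otherwise 3 ∣ 1 + 2^a). Every prime factor of N then divides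
-- x² + 1 with x = 2^(a/2) or 3^(b/2), so it is ≡ 1 (mod 4) by Fermat's little theorem. Hence
-- for each unitary prime-power component q of N, the odd number (q + 1)/2 divides
-- σ*(N) = 2^a 3^b, i.e. q = 2·3^y − 1 with 1 ≤ y ≤ b, distinct components having distinct y.
-- This bounds σ*(N)/N = ∏ (1 + 1/q) by 4·3^b/(3^(b+1) + 1), contradicting
-- σ*(N)/N = 2·2^a 3^b/((1 + 2^a)(1 + 3^b)) for 2^a ≥ 4 and 3^b ≥ 9.
module Submission where

open import Defs
open import Data.Bool using (T)
open import Data.Bool.Properties using (T?; T-∧)
open import Data.Empty using (⊥-elim)
open import Data.Fin using (Fin; zero; suc; toℕ; inject₁; fromℕ)
open import Data.Fin.Properties using (toℕ<n; toℕ-inject₁; toℕ-fromℕ)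
open import Data.List using (List; []; _∷_; _++_; map; filterᵇ)
open import Data.List.Membership.Propositional using (_∈_)
open import Data.List.Membership.Propositional.Properties
  using (∈-filter⁺; ∈-filter⁻; ∈-map⁺; ∈-map⁻; ∈-upTo⁺; ∈-++⁺ˡ; ∈-++⁺ʳ; ∈-++⁻; ∈-∃++)
open import Data.List.Membership.Propositional.Properties.WithK using (unique∧set⇒bag)
open import Data.List.Relation.Binary.BagAndSetEquality using (∼bag⇒↭)
open import Data.List.Relation.Binary.Permutation.Propositional using (_↭_; ↭⇒↭ₛ)
import Data.List.Relation.Binary.Permutation.Propositional.Properties as ↭
open import Data.List.Relation.Unary.All as All using (All; []; _∷_)
open import Data.List.Relation.Unary.AllPairs using ([]; _∷_)
open import Data.List.Relation.Unary.Unique.Propositional using (Unique)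
import Data.List.Relation.Unary.Unique.Propositional.Properties as Unique
open import Data.Nat
open import Data.Nat.Combinatorics using (_C_; nCn≡1; nCk≡n!/k![n-k]!; k![n∸k]!∣n!)
open import Data.Nat.Coprimality using (Coprime; coprime⇒gcd≡1; gcd≡1⇒coprime; coprime-divisor)
import Data.Nat.Coprimality as Coprime
open import Data.Nat.Divisibility
open import Data.Nat.DivMod using (_/_; m*[n/m]≡n; m*n/n≡m; m/n*n≡m)
open import Data.Nat.GCD using (gcd)
open import Data.Nat.Induction using (<-wellFounded)
open import Data.Nat.ListAction using (sum; product)
open import Data.Nat.ListAction.Properties using (sum-↭; sum-++; product-↭; ∈⇒∣product)
open import Data.Nat.Primality
open import Data.Nat.Primality.Factorisation using (factorise)
open import Data.Nat.Properties
open import Data.Nat.Tactic.RingSolver using (solve-∀)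
open import Data.Product using (∃-syntax; _×_; _,_; proj₁; proj₂)
open import Data.Sum using (_⊎_; inj₁; inj₂)
open import Function using (it; _∘_; _⇔_; mk⇔; Equivalence)
open import Induction.WellFounded using (Acc; acc)
open import Relation.Binary.PropositionalEquality
open import Relation.Binary.PropositionalEquality.Properties using (setoid)
open import Relation.Nullary using (¬_; yes; no)
open import Relation.Nullary.Decidable using (⌊_⌋; toWitness; fromWitness; from-yes)

open import Algebra.Properties.CommutativeSemigroup *-commutativeSemigroup using (x∙yz≈y∙xz)
open import Algebra.Properties.CommutativeSemiring.Binomial +-*-commutativeSemiring
  using (binomialExpansion) renaming (theorem to binomialTheorem)
open import Algebra.Definitions.RawSemiring +-*-rawSemiring
  using () renaming (_×_ to _×ᴿ_; _^_ to _^ᴿ_; sum to ∑)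
open import Algebra.Properties.Monoid.Sum +-0-monoid using (sum-init-last)
open import Data.List.Membership.DecPropositional _≟_ using (_∈?_)
open import Data.List.Relation.Binary.Permutation.Setoid.Properties (setoid ℕ) using (Unique-resp-↭)

private
  variable
    a b d m n p : ℕ

prime∤⇒coprime : Prime p → ¬ p ∣ n → Coprime p n
prime∤⇒coprime pp p∤n (d∣p , d∣n) with prime⇒irreducible pp d∣p
... | inj₁ d≡1 = d≡1
... | inj₂ refl = ⊥-elim (p∤n d∣n)

coprime-∣ˡ : Coprime a b → d ∣ a → Coprime d b
coprime-∣ˡ cop d∣a (e∣d , e∣b) = cop (∣-trans e∣d d∣a , e∣b)

coprime-∣ʳ : Coprime a b → d ∣ b → Coprime a d
coprime-∣ʳ cop d∣b (e∣a , e∣d) = cop (e∣a , ∣-trans e∣d d∣b)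

coprime-*ʳ : Coprime a b → Coprime a d → Coprime a (b * d)
coprime-*ʳ cab cad (e∣a , e∣bd) = cad (e∣a , coprime-divisor (coprime-∣ˡ cab e∣a) e∣bd)

coprime-^ʳ : ∀ k → Coprime a b → Coprime a (b ^ k)
coprime-^ʳ zero    cab (_ , d∣1) = ∣1⇒≡1 d∣1
coprime-^ʳ (suc k) cab = coprime-*ʳ cab (coprime-^ʳ k cab)

prime[3] : Prime 3
prime[3] = from-yes (prime? 3)

prime∤1 : Prime p → ¬ p ∣ 1
prime∤1 pp p∣1 = ¬prime[1] (subst Prime (∣1⇒≡1 p∣1) pp)

prime∣^⇒∣ : ∀ k → Prime p → p ∣ m ^ k → p ∣ m
prime∣^⇒∣ zero    pp p∣1 = ⊥-elim (prime∤1 pp p∣1)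
prime∣^⇒∣ {m = m} (suc k) pp p∣m^k+1 with euclidsLemma m (m ^ k) pp p∣m^k+1
... | inj₁ p∣m   = p∣m
... | inj₂ p∣m^k = prime∣^⇒∣ k pp p∣m^k

∣prime^⇒≡prime^ : ∀ k → Prime p → d ∣ p ^ k → ∃[ j ] j ≤ k × d ≡ p ^ j
∣prime^⇒≡prime^ zero pp d∣1 = 0 , z≤n , ∣1⇒≡1 d∣1
∣prime^⇒≡prime^ {p} {d} (suc k) pp d∣p^k+1 with p ∣? d
... | no p∤d with ∣prime^⇒≡prime^ k pp (coprime-divisor (Coprime.sym (prime∤⇒coprime pp p∤d)) d∣p^k+1)
...   | j , j≤k , d≡p^j = j , m≤n⇒m≤1+n j≤k , d≡p^j
∣prime^⇒≡prime^ {p} {d} (suc k) pp d∣p^k+1 | yes (divides e refl)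
  with ∣prime^⇒≡prime^ {d = e} k pp (*-cancelʳ-∣ p {{prime⇒nonZero pp}} (subst (e * p ∣_) (*-comm p (p ^ k)) d∣p^k+1))
...   | j , j≤k , e≡p^j = suc j , s≤s j≤k , trans (cong (_* p) e≡p^j) (*-comm (p ^ j) p)

even⊎odd : ∀ n → ∃[ k ] (n ≡ k * 2 ⊎ n ≡ 1 + k * 2)
even⊎odd zero = 0 , inj₁ refl
even⊎odd (suc n) with even⊎odd n
... | k , inj₁ refl = k , inj₂ refl
... | k , inj₂ refl = suc k , inj₁ refl

2∤1+2k : ∀ k → ¬ 2 ∣ 1 + k * 2
2∤1+2k k 2∣1+2k = 2∤1 (∣m+n∣m⇒∣n (subst (2 ∣_) (+-comm 1 (k * 2)) 2∣1+2k) (divides k refl))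
  where
  2∤1 : ¬ 2 ∣ 1
  2∤1 2∣1 with ∣⇒≤ 2∣1
  ... | s≤s ()

odd⇒nonZero : ¬ 2 ∣ n → NonZero n
odd⇒nonZero {zero}  2∤0 = ⊥-elim (2∤0 (divides 0 refl))
odd⇒nonZero {suc n} _   = _

2∣1+odd : ¬ 2 ∣ n → 2 ∣ suc n
2∣1+odd {n} 2∤n with even⊎odd n
... | k , inj₁ refl = ⊥-elim (2∤n (divides k refl))
... | k , inj₂ refl = divides (suc k) refl

factorOut : ∀ n → Prime p → .{{NonZero n}} → ∃[ k ] ∃[ r ] n ≡ p ^ k * r × ¬ p ∣ r
factorOut {p} n pp = go n (<-wellFounded n)
  where
  open ≡-Reasoning
  instance _ = prime⇒nonTrivial pp
  go : ∀ n → Acc _<_ n → .{{NonZero n}} → ∃[ k ] ∃[ r ] n ≡ p ^ k * r × ¬ p ∣ r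
  go n (acc rec) with p ∣? n
  ... | no p∤n = 0 , n , sym (*-identityˡ n) , p∤n
  ... | yes p∣n with go (quotient p∣n) (rec (quotient-< p∣n)) {{quotient≢0 p∣n}}
  ...   | k , r , n/p≡ , p∤r = suc k , r , (begin
    n                  ≡⟨ m∣n⇒n≡m*quotient p∣n ⟩
    p * quotient p∣n   ≡⟨ cong (p *_) n/p≡ ⟩
    p * (p ^ k * r)    ≡⟨ *-assoc p (p ^ k) r ⟨
    p ^ suc k * r      ∎) , p∤r

1<prime^suc : ∀ e → Prime p → 1 < p ^ suc e
1<prime^suc {p} e pp = ^-monoʳ-< p (nonTrivial⇒n>1 p {{prime⇒nonTrivial pp}}) {0} {suc e} z<s

^-*2 : ∀ x k → x ^ (k * 2) ≡ x ^ k * x ^ k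
^-*2 x k = trans (sym (^-*-assoc x k 2)) (cong (x ^ k *_) (*-identityʳ (x ^ k)))

^-odd : ∀ x m → x ^ (1 + m * 2) ≡ x * (x * x) ^ m
^-odd x zero    = refl
^-odd x (suc m) = cong (x *_) (trans (cong (x *_) (^-odd x m)) (sym (*-assoc x x ((x * x) ^ m))))

1+u∣1+u^odd : ∀ u i → suc u ∣ suc (u ^ (1 + i * 2))
1+u∣1+u^odd u zero    = subst (λ v → suc u ∣ suc v) (sym (*-identityʳ u)) ∣-refl
1+u∣1+u^odd u (suc i) = ∣m+n∣m⇒∣n
  (subst (suc u ∣_) (identity u w) (∣m∣n⇒∣m+n (∣n⇒∣m*n (u * w) ∣-refl) ∣-refl))
  (∣n⇒∣m*n u (1+u∣1+u^odd u i))
  where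
  w = u ^ (1 + i * 2)
  identity : ∀ u w → (u * w) * suc u + suc u ≡ u * suc w + suc (u * (u * w))
  identity = solve-∀

^-≡1mod4 : ∀ k → (∃[ j ] m ≡ 1 + j * 4) → ∃[ j ] m ^ k ≡ 1 + j * 4
^-≡1mod4 zero _ = 0 , refl
^-≡1mod4 {m} (suc k) (j , refl) with ^-≡1mod4 k (j , refl)
... | i , m^k≡ = j + i + j * i * 4 , trans (cong ((1 + j * 4) *_) m^k≡) (product≡ j i)
  where
  product≡ : ∀ j i → (1 + j * 4) * (1 + i * 4) ≡ 1 + (j + i + j * i * 4) * 4
  product≡ = solve-∀

-- Fermat's little theorem and primes dividing x² + 1

^ᴿ≡^ : ∀ x n → x ^ᴿ n ≡ x ^ n
^ᴿ≡^ x zero    = refl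
^ᴿ≡^ x (suc n) = cong (x *_) (^ᴿ≡^ x n)

×ᴿ≡* : ∀ n x → n ×ᴿ x ≡ n * x
×ᴿ≡* zero    x = refl
×ᴿ≡* (suc n) x = cong (x +_) (×ᴿ≡* n x)

1^ᴿ≡1 : ∀ n → 1 ^ᴿ n ≡ 1
1^ᴿ≡1 n = trans (^ᴿ≡^ 1 n) (^-zeroˡ n)

∣-∑ : ∀ {n} (f : Fin n → ℕ) → (∀ i → d ∣ f i) → d ∣ ∑ f
∣-∑ {n = zero}  f d∣f = divides 0 refl
∣-∑ {n = suc n} f d∣f = ∣m∣n⇒∣m+n (d∣f zero) (∣-∑ (λ i → f (suc i)) (λ i → d∣f (suc i)))

prime∤! : Prime p → m < p → ¬ p ∣ m !
prime∤! {m = zero}  pp _ p∣1 = prime∤1 pp p∣1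
prime∤! {m = suc m} pp m<p p∣m! with euclidsLemma (suc m) (m !) pp p∣m!
... | inj₁ p∣1+m = <⇒≱ m<p (∣⇒≤ p∣1+m)
... | inj₂ p∣m!  = prime∤! pp (<-trans (n<1+n m) m<p) p∣m!

prime∣C : Prime p → 0 < m → m < p → p ∣ p C m
prime∣C {p} {m} pp 0<m m<p with euclidsLemma (p C m) (m ! * (p ∸ m) !) pp p∣p!
  where
  instance
    _ = m !* (p ∸ m) !≢0
    _ = prime⇒nonZero pp
  p!≡ : (p C m) * (m ! * (p ∸ m) !) ≡ p !
  p!≡ = trans (cong (_* (m ! * (p ∸ m) !)) (nCk≡n!/k![n-k]! (<⇒≤ m<p))) (m/n*n≡m (k![n∸k]!∣n! (<⇒≤ m<p)))
  p∣p! : p ∣ (p C m) * (m ! * (p ∸ m) !)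
  p∣p! = subst (p ∣_) (sym p!≡) (n∣n! p)
    where
    n∣n! : ∀ n → .{{NonZero n}} → n ∣ n !
    n∣n! (suc n) = m∣m*n (n !)
... | inj₁ p∣C = p∣C
... | inj₂ p∣k!j! with euclidsLemma (m !) ((p ∸ m) !) pp p∣k!j!
...   | inj₁ p∣m! = ⊥-elim (prime∤! pp m<p p∣m!)
...   | inj₂ p∣j! = ⊥-elim (prime∤! pp (∸-monoʳ-< {p} {m} {0} 0<m (<⇒≤ m<p)) p∣j!)

freshman : Prime p → ∀ x → ∃[ c ] suc x ^ p ≡ suc (x ^ p + p * c)
freshman {p@(suc m)} pp x = c , (begin
  suc x ^ p                                  ≡⟨ ^ᴿ≡^ (suc x) p ⟨
  (1 + x) ^ᴿ p                               ≡⟨ binomialTheorem p 1 x ⟩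
  binomialExpansion 1 x p                    ≡⟨⟩
  first + ∑ term                             ≡⟨ cong (first +_) (sum-init-last term) ⟩
  first + (∑ middle + term (fromℕ m))        ≡⟨ cong₂ (λ a b → a + (b + term (fromℕ m))) first≡x^p ∑middle≡ ⟩
  x ^ p + (c * p + term (fromℕ m))           ≡⟨ cong (λ a → x ^ p + (c * p + a)) last≡1 ⟩
  x ^ p + (c * p + 1)                        ≡⟨ rearrange (x ^ p) c p ⟩
  suc (x ^ p + p * c)                        ∎)
  where
  open ≡-Reasoning
  rearrange : ∀ y c p → y + (c * p + 1) ≡ suc (y + p * c)
  rearrange = solve-∀
  term : Fin p → ℕ
  term k = (p C suc (toℕ k)) ×ᴿ (1 ^ᴿ suc (toℕ k) * x ^ᴿ (m ∸ toℕ k))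
  middle : Fin m → ℕ
  middle i = term (inject₁ i)
  p∣middle : ∀ i → p ∣ middle i
  p∣middle i = subst (p ∣_) (sym (×ᴿ≡* (p C suc k) _)) (∣m⇒∣m*n _ (prime∣C pp z<s (s<s k<m)))
    where
    k = toℕ (inject₁ i)
    k<m : k < m
    k<m = subst (_< m) (sym (toℕ-inject₁ i)) (toℕ<n i)
  p∣∑middle = ∣-∑ middle p∣middle
  c = quotient p∣∑middle
  ∑middle≡ : ∑ middle ≡ c * p
  ∑middle≡ = m∣n⇒n≡quotient*m p∣∑middle
  first = 1 ×ᴿ (1 * x ^ᴿ p)
  first≡x^p : first ≡ x ^ p
  first≡x^p = trans (+-identityʳ _) (trans (*-identityˡ _) (^ᴿ≡^ x p))
  last≡1 : term (fromℕ m) ≡ 1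
  last≡1 = begin
    term (fromℕ m)                          ≡⟨ cong (λ k → (p C suc k) ×ᴿ (1 ^ᴿ suc k * x ^ᴿ (m ∸ k))) (toℕ-fromℕ m) ⟩
    (p C p) ×ᴿ (1 ^ᴿ p * x ^ᴿ (m ∸ m))       ≡⟨ cong₂ (λ a b → a ×ᴿ (b * x ^ᴿ (m ∸ m))) (nCn≡1 p) (1^ᴿ≡1 p) ⟩
    1 ×ᴿ (1 * x ^ᴿ (m ∸ m))                  ≡⟨ cong (λ d → 1 ×ᴿ (1 * x ^ᴿ d)) (n∸n≡0 m) ⟩
    1 ×ᴿ (1 * 1)                             ≡⟨⟩
    1                                       ∎

fermat : Prime p → ∀ x → ∃[ c ] x ^ p ≡ x + p * c
fermat {p@(suc _)} pp zero    = 0 , sym (*-zeroʳ p)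
fermat {p}         pp (suc x) with fermat pp x | freshman pp x
... | c , x^p≡ | c′ , sx^p≡ = c + c′ , (begin
  suc x ^ p                    ≡⟨ sx^p≡ ⟩
  suc (x ^ p + p * c′)         ≡⟨ cong (λ y → suc (y + p * c′)) x^p≡ ⟩
  suc (x + p * c + p * c′)     ≡⟨ cong suc (+-assoc x (p * c) (p * c′)) ⟩
  suc (x + (p * c + p * c′))   ≡⟨ cong (λ y → suc (x + y)) (*-distribˡ-+ p c c′) ⟨
  suc (x + p * (c + c′))       ∎)
  where open ≡-Reasoning

odd-prime∣1+x²⇒≡1mod4 : ∀ {x} → Prime p → ¬ 2 ∣ p → p ∣ 1 + x * x → ∃[ j ] p ≡ 1 + j * 4
odd-prime∣1+x²⇒≡1mod4 {p} {x} pp 2∤p p∣1+x² with even⊎odd p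
... | k , inj₁ refl = ⊥-elim (2∤p (divides k refl))
... | k , inj₂ refl with even⊎odd k
...   | j , inj₁ refl = j , cong suc (*-assoc j 2 2)
-- For p = 3 + 4j, p ∣ 1 + x² ∣ 1 + (x²)^(1+2j), and x (1 + (x²)^(1+2j)) = x + x^p ≡ 2x (mod p)
-- by Fermat, so p ∣ 2x.
...   | j , inj₂ refl with euclidsLemma 2 x pp p∣2x
  where
  open ≡-Reasoning
  l = 1 + j * 2
  c = proj₁ (fermat pp x)
  p∣x[1+x^2l] : p ∣ x * (1 + (x * x) ^ l)
  p∣x[1+x^2l] = ∣n⇒∣m*n x (∣-trans p∣1+x² (1+u∣1+u^odd (x * x) j))
  x[1+x^2l]≡ : x * (1 + (x * x) ^ l) ≡ p * c + 2 * x
  x[1+x^2l]≡ = begin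
    x * (1 + (x * x) ^ l)    ≡⟨ *-distribˡ-+ x 1 _ ⟩
    x * 1 + x * (x * x) ^ l  ≡⟨ cong₂ _+_ (*-identityʳ x) (trans (sym (^-odd x l)) (proj₂ (fermat pp x))) ⟩
    x + (x + p * c)          ≡⟨ rearrange x (p * c) ⟩
    p * c + 2 * x            ∎
    where
    rearrange : ∀ x y → x + (x + y) ≡ y + 2 * x
    rearrange = solve-∀
  p∣2x : p ∣ 2 * x
  p∣2x = ∣m+n∣m⇒∣n (subst (p ∣_) x[1+x^2l]≡ p∣x[1+x^2l]) (∣m⇒∣m*n c ∣-refl)
...     | inj₁ p∣2 = ⊥-elim (<⇒≱ (s<s (s<s z<s)) (∣⇒≤ p∣2))
...     | inj₂ p∣x = ⊥-elim (prime∤1 pp (∣m+n∣m⇒∣n (subst (p ∣_) (+-comm 1 (x * x)) p∣1+x²) (∣m⇒∣m*n x p∣x)))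

-- Unitary divisors

infix 4 _∥_

_∥_ : ℕ → ℕ → Set
d ∥ n = ∃[ e ] n ≡ d * e × Coprime d e

∥⇒∣ : d ∥ n → d ∣ n
∥⇒∣ {d} (e , refl , _) = ∣m⇒∣m*n e ∣-refl

unitaryDivisors : ℕ → List ℕ
unitaryDivisors n = filterᵇ (isUnitaryDivisorᵇ n) (candidates n)

isUnitaryDivisorᵇ⇔∥ : ∀ n d → .{{NonZero n}} → T (isUnitaryDivisorᵇ n d) ⇔ d ∥ n
isUnitaryDivisorᵇ⇔∥ n zero = mk⇔ (λ ()) λ { (e , n≡0 , _) → ≢-nonZero⁻¹ n n≡0 }
isUnitaryDivisorᵇ⇔∥ n d@(suc _) = mk⇔ to from
  where
  to : T (isUnitaryDivisorᵇ n d) → d ∥ n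
  to t with Equivalence.to (T-∧ {⌊ d ∣? n ⌋} {⌊ gcd d (n / d) ≟ 1 ⌋}) t
  ... | t₁ , t₂ = n / d , sym (m*[n/m]≡n (toWitness t₁)) , gcd≡1⇒coprime (toWitness t₂)
  from : d ∥ n → T (isUnitaryDivisorᵇ n d)
  from (e , refl , cop) = Equivalence.from (T-∧ {⌊ d ∣? d * e ⌋} {⌊ gcd d (d * e / d) ≟ 1 ⌋}) (fromWitness (∣m⇒∣m*n e ∣-refl) , fromWitness gcd≡1)
    where
    gcd≡1 : gcd d (d * e / d) ≡ 1
    gcd≡1 = trans (cong (gcd d) (trans (cong (_/ d) (*-comm d e)) (m*n/n≡m e d))) (coprime⇒gcd≡1 cop)

∈-unitaryDivisors⇔ : .{{NonZero n}} → d ∈ unitaryDivisors n ⇔ d ∥ n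
∈-unitaryDivisors⇔ {n} {d} = mk⇔ to from
  where
  test? = T? ∘ isUnitaryDivisorᵇ n
  to : d ∈ unitaryDivisors n → d ∥ n
  to d∈ = Equivalence.to (isUnitaryDivisorᵇ⇔∥ n d) (proj₂ (∈-filter⁻ test? {xs = candidates n} d∈))
  from : ∀ {d} → d ∥ n → d ∈ unitaryDivisors n
  from {zero}  (_ , n≡0 , _) = ⊥-elim (≢-nonZero⁻¹ n n≡0)
  from {suc k} d∥n = ∈-filter⁺ test? (∈-map⁺ suc (∈-upTo⁺ (∣⇒≤ (∥⇒∣ d∥n)))) (Equivalence.from (isUnitaryDivisorᵇ⇔∥ n (suc k)) d∥n)

unitaryDivisors-unique : ∀ n → Unique (unitaryDivisors n)
unitaryDivisors-unique n = Unique.filter⁺ _ (Unique.map⁺ suc-injective (Unique.upTo⁺ n))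

σ*≡sum : ∀ {ds} → .{{NonZero n}} → Unique ds → (∀ {d} → d ∈ ds ⇔ d ∥ n) → σ* n ≡ sum ds
σ*≡sum {n} uniq ∈ds⇔ = sum-↭ (∼bag⇒↭ (unique∧set⇒bag (unitaryDivisors-unique n) uniq
  (λ {d} → mk⇔ (Equivalence.from ∈ds⇔ ∘ Equivalence.to ∈-unitaryDivisors⇔)
                (Equivalence.from ∈-unitaryDivisors⇔ ∘ Equivalence.to ∈ds⇔))))

∥⇒∥-* : Coprime m n → d ∥ n → d ∥ m * n
∥⇒∥-* {m} {d = d} cop (e , refl , d⊥e) =
  m * e , x∙yz≈y∙xz m d e , coprime-*ʳ (Coprime.sym (coprime-∣ʳ cop (∣m⇒∣m*n e ∣-refl))) d⊥e

*∥-* : Coprime m n → d ∥ n → m * d ∥ m * n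
*∥-* {m} {d = d} cop (e , refl , d⊥e) =
  e , sym (*-assoc m d e) , Coprime.sym (coprime-*ʳ (Coprime.sym (coprime-∣ʳ cop (∣n⇒∣m*n d ∣-refl))) (Coprime.sym d⊥e))

sum-map-*ˡ : ∀ m ns → sum (map (m *_) ns) ≡ m * sum ns
sum-map-*ˡ m []       = sym (*-zeroʳ m)
sum-map-*ˡ m (n ∷ ns) = trans (cong (m * n +_) (sum-map-*ˡ m ns)) (sym (*-distribˡ-+ m n (sum ns)))

module _ {p e r : ℕ} (pp : Prime p) (p∤r : ¬ p ∣ r) .{{_ : NonZero r}} where

  private
    q = p ^ suc e

    instance
      _ = m^n≢0 p (suc e) {{prime⇒nonZero pp}}
      _ = m*n≢0 q r

    p∣q : p ∣ q
    p∣q = ∣m⇒∣m*n (p ^ e) ∣-refl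

    coprime-q : ¬ p ∣ n → Coprime n q
    coprime-q p∤n = coprime-^ʳ (suc e) (Coprime.sym (prime∤⇒coprime pp p∤n))

  ∥-prime^*⇒ : d ∥ p ^ suc e * r → d ∥ r ⊎ ∃[ d′ ] d ≡ p ^ suc e * d′ × d′ ∥ r
  ∥-prime^*⇒ {d} (f , qr≡df , d⊥f) with p ∣? d
  ... | no p∤d = inj₁ (w , r≡dw , coprime-∣ʳ d⊥f (divides q f≡qw))
    where
    open ≡-Reasoning
    instance _ = m*n≢0⇒m≢0 d {{subst NonZero qr≡df it}}
    d∣r : d ∣ r
    d∣r = coprime-divisor (coprime-q p∤d) (divides f (trans qr≡df (*-comm d f)))
    w = quotient d∣r
    r≡dw : r ≡ d * w
    r≡dw = m∣n⇒n≡m*quotient d∣r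
    f≡qw : f ≡ q * w
    f≡qw = *-cancelˡ-≡ f (q * w) d (begin
      d * f        ≡⟨ qr≡df ⟨
      q * r        ≡⟨ cong (q *_) r≡dw ⟩
      q * (d * w)  ≡⟨ x∙yz≈y∙xz q d w ⟩
      d * (q * w)  ∎)
  ... | yes p∣d = inj₂ (w , d≡qw , f , r≡wf , coprime-∣ˡ d⊥f (divides q d≡qw))
    where
    open ≡-Reasoning
    p∤f : ¬ p ∣ f
    p∤f p∣f = ¬prime[1] (subst Prime (d⊥f (p∣d , p∣f)) pp)
    instance _ = m*n≢0⇒n≢0 d {{subst NonZero qr≡df it}}
    f∣r : f ∣ r
    f∣r = coprime-divisor (coprime-q p∤f) (divides d qr≡df)
    w = quotient f∣r
    r≡wf : r ≡ w * f
    r≡wf = m∣n⇒n≡quotient*m f∣r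
    d≡qw : d ≡ q * w
    d≡qw = *-cancelʳ-≡ d (q * w) f (begin
      d * f        ≡⟨ qr≡df ⟨
      q * r        ≡⟨ cong (q *_) r≡wf ⟩
      q * (w * f)  ≡⟨ *-assoc q w f ⟨
      q * w * f    ∎)

  private
    ds = unitaryDivisors r

    ds-disjoint : ¬ (d ∈ ds × d ∈ map (q *_) ds)
    ds-disjoint (d∈ds , d∈qds) with ∈-map⁻ (q *_) d∈qds
    ... | w , _ , refl = p∤r (∣-trans (∣-trans p∣q (∣m⇒∣m*n w ∣-refl)) (∥⇒∣ (Equivalence.to ∈-unitaryDivisors⇔ d∈ds)))

    ∈ds++qds⇔ : d ∈ ds ++ map (q *_) ds ⇔ d ∥ q * r
    ∈ds++qds⇔ = mk⇔ to from
      where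
      q⊥r : Coprime q r
      q⊥r = Coprime.sym (coprime-q p∤r)
      to : d ∈ ds ++ map (q *_) ds → d ∥ q * r
      to d∈ with ∈-++⁻ ds d∈
      ... | inj₁ d∈ds = ∥⇒∥-* q⊥r (Equivalence.to ∈-unitaryDivisors⇔ d∈ds)
      ... | inj₂ d∈qds with ∈-map⁻ (q *_) d∈qds
      ...   | w , w∈ds , refl = *∥-* q⊥r (Equivalence.to ∈-unitaryDivisors⇔ w∈ds)
      from : d ∥ q * r → d ∈ ds ++ map (q *_) ds
      from d∥qr with ∥-prime^*⇒ d∥qr
      ... | inj₁ d∥r = ∈-++⁺ˡ (Equivalence.from ∈-unitaryDivisors⇔ d∥r)
      ... | inj₂ (w , refl , w∥r) = ∈-++⁺ʳ ds (∈-map⁺ (q *_) (Equivalence.from ∈-unitaryDivisors⇔ w∥r))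

  σ*-prime^* : σ* (p ^ suc e * r) ≡ (1 + p ^ suc e) * σ* r
  σ*-prime^* = begin
    σ* (q * r)                  ≡⟨ σ*≡sum ds++qds-unique ∈ds++qds⇔ ⟩
    sum (ds ++ map (q *_) ds)   ≡⟨ sum-++ ds (map (q *_) ds) ⟩
    σ* r + sum (map (q *_) ds)  ≡⟨ cong (σ* r +_) (sum-map-*ˡ q ds) ⟩
    (1 + q) * σ* r              ∎
    where
    open ≡-Reasoning
    ds++qds-unique : Unique (ds ++ map (q *_) ds)
    ds++qds-unique = Unique.++⁺ (unitaryDivisors-unique r)
      (Unique.map⁺ (*-cancelˡ-≡ _ _ q) (unitaryDivisors-unique r)) ds-disjoint

primePowerComponent : .{{NonZero n}} → n ≢ 1 →
  ∃[ p ] ∃[ e ] ∃[ r ] Prime p × ¬ p ∣ r × n ≡ p ^ suc e * r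
primePowerComponent {n} n≢1 with factorise n
... | record { factors = [] ; isFactorisation = n≡1 } = ⊥-elim (n≢1 n≡1)
... | record { factors = p ∷ ps ; isFactorisation = n≡pps ; factorsPrime = pp ∷ _ }
  with factorOut n pp
...   | zero  , r , n≡r , p∤r = ⊥-elim (p∤r (subst (p ∣_) (trans (sym n≡pps) (trans n≡r (*-identityˡ r))) (m∣m*n (product ps))))
...   | suc e , r , n≡ , p∤r = p , e , r , pp , p∤r , n≡

odd⇒2∣σ* : .{{NonZero n}} → n ≢ 1 → ¬ 2 ∣ n → 2 ∣ σ* n
odd⇒2∣σ* n≢1 2∤n with primePowerComponent n≢1
... | p , e , r , pp , p∤r , refl =
  subst (2 ∣_) (sym (σ*-prime^* {e = e} pp p∤r)) (∣m⇒∣m*n (σ* r) (2∣1+odd {p ^ suc e} (2∤n ∘ ∣m⇒∣m*n r)))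
  where instance _ = m*n≢0⇒n≢0 (p ^ suc e)

IsPrimePower : ℕ → Set
IsPrimePower q = ∃[ p ] ∃[ e ] Prime p × q ≡ p ^ suc e

record UnitaryFactorisation (n : ℕ) : Set where
  field
    components  : List ℕ
    product≡    : product components ≡ n
    σ*≡         : product (map suc components) ≡ σ* n
    unique      : Unique components
    primePowers : All IsPrimePower components

unitaryFactorise : ∀ n → .{{NonZero n}} → UnitaryFactorisation n
unitaryFactorise n = go n (<-wellFounded n)
  where
  go : ∀ n → Acc _<_ n → .{{NonZero n}} → UnitaryFactorisation n
  go n (acc rec) with n ≟ 1
  ... | yes refl = record { components = [] ; product≡ = refl ; σ*≡ = refl ; unique = [] ; primePowers = [] }
  ... | no n≢1 with primePowerComponent n≢1
  ...   | p , e , r , pp , p∤r , refl = record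
    { components  = q ∷ components
    ; product≡    = cong (q *_) product≡
    ; σ*≡         = trans (cong (suc q *_) σ*≡) (sym (σ*-prime^* {e = e} pp p∤r))
    ; unique      = All.tabulate q∉ ∷ unique
    ; primePowers = (p , e , pp , refl) ∷ primePowers
    }
    where
    q = p ^ suc e
    instance _ = m*n≢0⇒n≢0 q
    r<qr : r < q * r
    r<qr = subst (r <_) (*-comm r q) (m<m*n r q (1<prime^suc e pp))
    open UnitaryFactorisation (go r (rec r<qr))
    q∉ : ∀ {x} → x ∈ components → q ≢ x
    q∉ x∈ refl = p∤r (∣-trans (∣m⇒∣m*n (p ^ e) ∣-refl) (subst (q ∣_) product≡ (∈⇒∣product x∈)))

-- Bounding ∏ (1 + 1/q) over admissible components q

unique-∈⇒↭∷ : ∀ {x} {xs : List ℕ} → Unique xs → x ∈ xs → ∃[ ys ] xs ↭ x ∷ ys × Unique ys × All (x ≢_) ys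
unique-∈⇒↭∷ u x∈xs with ∈-∃++ x∈xs
... | as , bs , refl with Unique-resp-↭ (↭⇒↭ₛ (↭.shift _ as bs)) u
...   | x∉ ∷ u′ = as ++ bs , ↭.shift _ as bs , u′ , x∉

Admissible : ℕ → ℕ → Set
Admissible K q = ∃[ y ] y < K × suc q ≡ 2 * 3 ^ suc y

largestAdmissible : ℕ → ℕ
largestAdmissible K = pred (2 * 3 ^ suc K)

suc-largestAdmissible : ∀ K → suc (largestAdmissible K) ≡ 2 * 3 ^ suc K
suc-largestAdmissible K = suc-pred (2 * 3 ^ suc K) {{m*n≢0 2 (3 ^ suc K) {{_}} {{m^n≢0 3 (suc K)}}}}

admissible-lower : ∀ {K q} → q ≢ largestAdmissible K → Admissible (suc K) q → Admissible K q
admissible-lower {K} q≢top (y , y<1+K , sq≡) with m<1+n⇒m<n∨m≡n y<1+K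
... | inj₁ y<K  = y , y<K , sq≡
... | inj₂ refl = ⊥-elim (q≢top (suc-injective (trans sq≡ (sym (suc-largestAdmissible y)))))

bound-step-absent : ∀ t S P → (1 + 3 * t) * S ≤ 4 * t * P →
                    (1 + 3 * (3 * t)) * S ≤ 4 * (3 * t) * P
bound-step-absent t S P ih = begin
  (1 + 3 * (3 * t)) * S  ≤⟨ *-monoˡ-≤ S (m≤n+m (1 + 3 * (3 * t)) 2) ⟩
  (2 + (1 + 3 * (3 * t))) * S  ≡⟨ e₁ t S ⟩
  3 * ((1 + 3 * t) * S)  ≤⟨ *-monoʳ-≤ 3 ih ⟩
  3 * (4 * t * P)        ≡⟨ e₂ t P ⟩
  4 * (3 * t) * P        ∎
  where
  open ≤-Reasoning
  e₁ : ∀ t S → (2 + (1 + 3 * (3 * t))) * S ≡ 3 * ((1 + 3 * t) * S)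
  e₁ = solve-∀
  e₂ : ∀ t P → 3 * (4 * t * P) ≡ 4 * (3 * t) * P
  e₂ = solve-∀

-- With s = 3t and q = 2s − 1, clearing the factor 1 + s reduces the step to
-- 2t (1 + 3s) ≤ (2s − 1)(1 + s), that is, to 1 ≤ t.
bound-step-present : ∀ t q S P → suc q ≡ 2 * (3 * t) → (1 + 3 * t) * S ≤ 4 * t * P →
                     (1 + 3 * (3 * t)) * (suc q * S) ≤ 4 * (3 * t) * (q * P)
bound-step-present (suc v) q S P sq≡ ih with suc-injective (trans sq≡ (e₀ v))
  where
  e₀ : ∀ v → 2 * (3 * suc v) ≡ suc (5 + v * 6)
  e₀ = solve-∀
... | refl = *-cancelʳ-≤ _ _ (4 + v * 3) (begin
  (1 + 3 * (3 * suc v)) * ((6 + v * 6) * S) * (4 + v * 3)  ≡⟨ e₁ v S ⟩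
  (10 + v * 9) * (6 + v * 6) * ((1 + 3 * suc v) * S)      ≤⟨ *-monoʳ-≤ ((10 + v * 9) * (6 + v * 6)) ih ⟩
  (10 + v * 9) * (6 + v * 6) * (4 * suc v * P)            ≤⟨ m≤m+n _ (v * (12 * suc v * P)) ⟩
  (10 + v * 9) * (6 + v * 6) * (4 * suc v * P) + v * (12 * suc v * P)  ≡⟨ e₂ v P ⟩
  4 * (3 * suc v) * ((5 + v * 6) * P) * (4 + v * 3)       ∎)
  where
  open ≤-Reasoning
  e₁ : ∀ v S → (1 + 3 * (3 * suc v)) * ((6 + v * 6) * S) * (4 + v * 3) ≡ (10 + v * 9) * (6 + v * 6) * ((1 + 3 * suc v) * S)
  e₁ = solve-∀
  e₂ : ∀ v P → (10 + v * 9) * (6 + v * 6) * (4 * suc v * P) + v * (12 * suc v * P) ≡ 4 * (3 * suc v) * ((5 + v * 6) * P) * (4 + v * 3)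
  e₂ = solve-∀

-- By induction on K: going from K to K + 1 adds the single new admissible value
-- 2·3^(K+1) − 1, which occurs at most once in Q.
product-bound : ∀ K {Q} → Unique Q → All (Admissible K) Q →
                (1 + 3 ^ suc K) * product (map suc Q) ≤ 4 * 3 ^ K * product Q
product-bound zero    {[]}    _ []                  = ≤-refl
product-bound zero    {_ ∷ _} _ ((_ , () , _) ∷ _)
product-bound (suc K) {Q} uQ admQ with largestAdmissible K ∈? Q
... | no top∉Q = bound-step-absent (3 ^ K) _ _ (product-bound K uQ
  (All.tabulate λ q∈Q → admissible-lower (λ { refl → top∉Q q∈Q }) (All.lookup admQ q∈Q)))
... | yes top∈Q with unique-∈⇒↭∷ uQ top∈Q
...   | Q′ , Q↭ , uQ′ , top≢Q′ with ↭.All-resp-↭ Q↭ admQ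
...     | _ ∷ admQ′ = subst₂ (λ S P → (1 + 3 ^ suc (suc K)) * S ≤ 4 * 3 ^ suc K * P)
  (sym (product-↭ (↭.map⁺ suc Q↭))) (sym (product-↭ Q↭))
  (bound-step-present (3 ^ K) (largestAdmissible K) _ _ (suc-largestAdmissible K) (product-bound K uQ′
    (All.zipWith (λ (top≢q , adm) → admissible-lower (top≢q ∘ sym) adm) (top≢Q′ , admQ′))))

bound-contradiction : ∀ {X Y N} → 4 ≤ X → 9 ≤ Y → 2 * N ≡ (1 + X) * (1 + Y) →
                      ¬ (1 + 3 * Y) * (X * Y) ≤ 4 * Y * N
bound-contradiction {X} {Y} {N} 4≤X 9≤Y 2N≡ le with m≤n⇒∃[o]m+o≡n 4≤X | m≤n⇒∃[o]m+o≡n 9≤Y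
... | x , refl | y , refl = m+1+n≰m _ (begin
  4 * ((1 + X) * (1 + Y)) + suc W  ≡⟨ identity x y ⟨
  2 * ((1 + 3 * Y) * X)            ≤⟨ *-monoʳ-≤ 2 (*-cancelʳ-≤ ((1 + 3 * Y) * X) (4 * N) Y (subst₂ _≤_ (sym (*-assoc (1 + 3 * Y) X Y)) (swap Y N) le)) ⟩
  2 * (4 * N)                      ≡⟨ x∙yz≈y∙xz 2 4 N ⟩
  4 * (2 * N)                      ≡⟨ cong (4 *_) 2N≡ ⟩
  4 * ((1 + X) * (1 + Y))          ∎)
  where
  open ≤-Reasoning
  W = 23 + 4 * y + 16 * x + 2 * x * y
  identity : ∀ x y → 2 * ((1 + 3 * (9 + y)) * (4 + x)) ≡ 4 * ((5 + x) * (10 + y)) + suc (23 + 4 * y + 16 * x + 2 * x * y)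
  identity = solve-∀
  swap : ∀ Y N → 4 * Y * N ≡ 4 * N * Y
  swap = solve-∀

module _ {N} (2∤N : ¬ 2 ∣ N) (σ*σ*N≡2N : σ* (σ* N) ≡ 2 * N) where

  private
    instance
      N≢0 : NonZero N
      N≢0 = odd⇒nonZero 2∤N

      σ*N≢0 : NonZero (σ* N)
      σ*N≢0 = ≢-nonZero λ σ*N≡0 → ≢-nonZero⁻¹ (2 * N) {{m*n≢0 2 N}} (trans (sym σ*σ*N≡2N) (cong σ* σ*N≡0))

    N≢1 : N ≢ 1
    N≢1 N≡1 with trans (cong (σ* ∘ σ*) (sym N≡1)) (trans σ*σ*N≡2N (cong (2 *_) N≡1))
    ... | ()

    4∤2N : ¬ 4 ∣ 2 * N
    4∤2N 4∣2N = 2∤N (*-cancelˡ-∣ 2 4∣2N)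

    3∤2^ : ∀ k → ¬ 3 ∣ 2 ^ k
    3∤2^ k 3∣2^k with ∣⇒≤ (prime∣^⇒∣ k prime[3] 3∣2^k)
    ... | s≤s (s≤s ())

    2∤3^ : ∀ k → ¬ 2 ∣ 3 ^ k
    2∤3^ k 2∣3^k = 2∤1+2k 1 (prime∣^⇒∣ k prime[2] 2∣3^k)

  σ*N≡2^a*3^b*r : 3 ∣ σ* N →
    ∃[ a ] ∃[ b ] ∃[ r ] σ* N ≡ 2 ^ suc a * (3 ^ suc b * r) × ¬ 2 ∣ r × ¬ 3 ∣ r
  σ*N≡2^a*3^b*r 3∣σ*N with factorOut (σ* N) prime[2]
  ... | zero  , m , σ*N≡m , 2∤m =
    ⊥-elim (2∤m (subst (2 ∣_) (trans σ*N≡m (*-identityˡ m)) (odd⇒2∣σ* N≢1 2∤N)))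
  ... | suc a , m , σ*N≡ , 2∤m with factorOut m prime[3] {{odd⇒nonZero 2∤m}}
  ...   | zero  , r , m≡r , 3∤r with euclidsLemma (2 ^ suc a) m prime[3] (subst (3 ∣_) σ*N≡ 3∣σ*N)
  ...     | inj₁ 3∣2^a = ⊥-elim (3∤2^ (suc a) 3∣2^a)
  ...     | inj₂ 3∣m   = ⊥-elim (3∤r (subst (3 ∣_) (trans m≡r (*-identityˡ r)) 3∣m))
  σ*N≡2^a*3^b*r 3∣σ*N | suc a , m , σ*N≡ , 2∤m | suc b , r , m≡ , 3∤r =
    a , b , r , trans σ*N≡ (cong (2 ^ suc a *_) m≡) , 2∤m ∘ (subst (2 ∣_) (sym m≡) ∘ ∣n⇒∣m*n (3 ^ suc b)) , 3∤r

  2N≡[1+2^a][1+3^b]σ*r : ∀ {a b r} → σ* N ≡ 2 ^ suc a * (3 ^ suc b * r) → ¬ 2 ∣ r → ¬ 3 ∣ r →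
    2 * N ≡ (1 + 2 ^ suc a) * ((1 + 3 ^ suc b) * σ* r)
  2N≡[1+2^a][1+3^b]σ*r {a} {b} {r} σ*N≡ 2∤r 3∤r = begin
    2 * N                                         ≡⟨ σ*σ*N≡2N ⟨
    σ* (σ* N)                                     ≡⟨ cong σ* σ*N≡ ⟩
    σ* (2 ^ suc a * (3 ^ suc b * r))              ≡⟨ σ*-prime^* {e = a} prime[2] 2∤3^b*r ⟩
    (1 + 2 ^ suc a) * σ* (3 ^ suc b * r)          ≡⟨ cong ((1 + 2 ^ suc a) *_) (σ*-prime^* {e = b} prime[3] 3∤r) ⟩
    (1 + 2 ^ suc a) * ((1 + 3 ^ suc b) * σ* r)    ∎
    where
    open ≡-Reasoning
    instance
      _ = odd⇒nonZero 2∤r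
      _ = m*n≢0 (3 ^ suc b) r {{m^n≢0 3 (suc b)}}
    2∤3^b*r : ¬ 2 ∣ 3 ^ suc b * r
    2∤3^b*r 2∣3^b*r with euclidsLemma (3 ^ suc b) r prime[2] 2∣3^b*r
    ... | inj₁ 2∣3^b = 2∤3^ (suc b) 2∣3^b
    ... | inj₂ 2∣r   = 2∤r 2∣r

  r≡1 : ∀ {a b r} → 2 * N ≡ (1 + 2 ^ suc a) * ((1 + 3 ^ suc b) * σ* r) → ¬ 2 ∣ r → r ≡ 1
  r≡1 {a} {b} {r} 2N≡ 2∤r with r ≟ 1
  ... | yes r≡1 = r≡1
  ... | no  r≢1 = ⊥-elim (4∤2N (subst (4 ∣_) (sym 2N≡) (∣n⇒∣m*n (1 + 2 ^ suc a)
          (*-pres-∣ (2∣1+odd (2∤3^ (suc b))) (odd⇒2∣σ* {{odd⇒nonZero 2∤r}} r≢1 2∤r)))))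

  3-exponent-even : ∀ {A} b → 2 * N ≡ A * (1 + 3 ^ suc b) → ∃[ j ] suc b ≡ suc j * 2
  3-exponent-even {A} b 2N≡ with even⊎odd (suc b)
  ... | suc j , inj₁ 1+b≡ = j , 1+b≡
  ... | k     , inj₂ 1+b≡ = ⊥-elim (4∤2N (subst (4 ∣_) (sym 2N≡)
          (∣n⇒∣m*n A (subst (λ e → 4 ∣ 1 + 3 ^ e) (sym 1+b≡) (1+u∣1+u^odd 3 k)))))

  2-exponent-even : ∀ {B} a → ¬ 3 ∣ N → 2 * N ≡ (1 + 2 ^ suc a) * B → ∃[ i ] suc a ≡ suc i * 2
  2-exponent-even {B} a 3∤N 2N≡ with even⊎odd (suc a)
  ... | suc i , inj₁ 1+a≡ = i , 1+a≡
  ... | k     , inj₂ 1+a≡ with euclidsLemma 2 N prime[3] (subst (3 ∣_) (sym 2N≡)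
          (∣m⇒∣m*n B (subst (λ e → 3 ∣ 1 + 2 ^ e) (sym 1+a≡) (1+u∣1+u^odd 2 k))))
  ...   | inj₁ 3∣2 = ⊥-elim (3∤2^ 1 3∣2)
  ...   | inj₂ 3∣N = ⊥-elim (3∤N 3∣N)

  σ*N≡2^2i*3^2j : 3 ∣ σ* N → ¬ 3 ∣ N → ∃[ i ] ∃[ j ]
    σ* N ≡ 2 ^ (suc i * 2) * 3 ^ (suc j * 2) × 2 * N ≡ (1 + 2 ^ (suc i * 2)) * (1 + 3 ^ (suc j * 2))
  σ*N≡2^2i*3^2j 3∣σ*N 3∤N with σ*N≡2^a*3^b*r 3∣σ*N
  ... | a , b , r , σ*N≡ , 2∤r , 3∤r with r≡1 {a} {b} (2N≡[1+2^a][1+3^b]σ*r {a} {b} σ*N≡ 2∤r 3∤r) 2∤r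
  ... | refl with 2N≡[1+2^a][1+3^b]σ*r {a} {b} σ*N≡ 2∤r 3∤r
  ... | 2N≡ with 2-exponent-even a 3∤N 2N≡ | 3-exponent-even {1 + 2 ^ suc a} b (trans 2N≡ (cong ((1 + 2 ^ suc a) *_) (*-identityʳ (1 + 3 ^ suc b))))
  ... | i , 1+a≡ | j , 1+b≡ = i , j ,
    subst₂ (λ e f → σ* N ≡ 2 ^ e * f) 1+a≡ (trans (*-identityʳ _) (cong (3 ^_) 1+b≡)) σ*N≡ ,
    subst₂ (λ e f → 2 * N ≡ (1 + 2 ^ e) * f) 1+a≡ (trans (*-identityʳ _) (cong (λ e → 1 + 3 ^ e) 1+b≡)) 2N≡

  component-admissible : ∀ {i j q} → σ* N ≡ 2 ^ (suc i * 2) * 3 ^ (suc j * 2) →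
    2 * N ≡ (1 + 2 ^ (suc i * 2)) * (1 + 3 ^ (suc j * 2)) →
    IsPrimePower q → q ∣ N → suc q ∣ σ* N → Admissible (suc j * 2) q
  component-admissible {i} {j} σ*N≡ 2N≡ (p , e , pp , refl) q∣N 1+q∣σ*N =
    positive-power (∣prime^⇒≡prime^ (suc j * 2) prime[3] o∣3^b)
    where
    p∣N : p ∣ N
    p∣N = ∣-trans (∣m⇒∣m*n (p ^ e) ∣-refl) q∣N
    2∤p : ¬ 2 ∣ p
    2∤p 2∣p = 2∤N (∣-trans 2∣p p∣N)
    p≡1mod4 : ∃[ k ] p ≡ 1 + k * 4
    p≡1mod4 with euclidsLemma (1 + 2 ^ (suc i * 2)) (1 + 3 ^ (suc j * 2)) pp (subst (p ∣_) 2N≡ (∣n⇒∣m*n 2 p∣N))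
    ... | inj₁ p∣1+X = odd-prime∣1+x²⇒≡1mod4 {x = 2 ^ suc i} pp 2∤p (subst (λ z → p ∣ 1 + z) (^-*2 2 (suc i)) p∣1+X)
    ... | inj₂ p∣1+Y = odd-prime∣1+x²⇒≡1mod4 {x = 3 ^ suc j} pp 2∤p (subst (λ z → p ∣ 1 + z) (^-*2 3 (suc j)) p∣1+Y)
    k = proj₁ (^-≡1mod4 (suc e) p≡1mod4)
    o = 1 + k * 2
    1+q≡2o : suc (p ^ suc e) ≡ 2 * o
    1+q≡2o = trans (cong suc (proj₂ (^-≡1mod4 (suc e) p≡1mod4))) (identity k)
      where
      identity : ∀ k → 2 + k * 4 ≡ 2 * (1 + k * 2)
      identity = solve-∀
    o∣3^b : o ∣ 3 ^ (suc j * 2)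
    o∣3^b = coprime-divisor (coprime-^ʳ (suc i * 2) (Coprime.sym (prime∤⇒coprime prime[2] (2∤1+2k k))))
      (∣-trans (divides 2 1+q≡2o) (subst (suc (p ^ suc e) ∣_) σ*N≡ 1+q∣σ*N))
    positive-power : ∃[ y ] y ≤ suc j * 2 × o ≡ 3 ^ y → Admissible (suc j * 2) (p ^ suc e)
    positive-power (zero  , _   , o≡1)   = ⊥-elim (<⇒≢ (1<prime^suc e pp) (sym (suc-injective (trans 1+q≡2o (cong (2 *_) o≡1)))))
    positive-power (suc y , y<b , o≡3^y) = y , y<b , trans 1+q≡2o (cong (2 *_) o≡3^y)

  3∣σ*N⇒3∣N : 3 ∣ σ* N → 3 ∣ N
  3∣σ*N⇒3∣N 3∣σ*N with 3 ∣? N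
  ... | yes 3∣N = 3∣N
  ... | no  3∤N with σ*N≡2^2i*3^2j 3∣σ*N 3∤N
  ...   | i , j , σ*N≡ , 2N≡ = ⊥-elim (bound-contradiction 4≤X 9≤Y 2N≡ (subst (λ S → (1 + 3 * Y) * S ≤ 4 * Y * N) σ*N≡ bound))
    where
    open UnitaryFactorisation (unitaryFactorise N)
    X = 2 ^ (suc i * 2)
    Y = 3 ^ (suc j * 2)
    4≤X : 4 ≤ X
    4≤X = ^-monoʳ-≤ 2 (m≤m+n 2 (i * 2))
    9≤Y : 9 ≤ Y
    9≤Y = ^-monoʳ-≤ 3 (m≤m+n 2 (j * 2))
    admissibleComponents : All (Admissible (suc j * 2)) components
    admissibleComponents = All.tabulate λ q∈ → component-admissible {i} {j} σ*N≡ 2N≡ (All.lookup primePowers q∈)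
      (subst (_ ∣_) product≡ (∈⇒∣product q∈)) (subst (_ ∣_) σ*≡ (∈⇒∣product (∈-map⁺ suc q∈)))
    bound : (1 + 3 * Y) * σ* N ≤ 4 * Y * N
    bound = subst₂ (λ S P → (1 + 3 * Y) * S ≤ 4 * Y * P) σ*≡ product≡ (product-bound (suc j * 2) unique admissibleComponents)

lemma4p2 : (N : ℕ) → ¬ (2 ∣ N) → σ* (σ* N) ≡ 2 * N → N ≢ 9 → N ≢ 165
             → 3 ∣ σ* N → 3 ∣ N
lemma4p2 N 2∤N σ*σ*N≡2N _ _ = 3∣σ*N⇒3∣N 2∤N σ*σ*N≡2N
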